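{- Let $\gamma$ be a typing context, $s$ a structural resource term and $a,a'$ resource types. If $\pi$ is a type derivation of $\gamma \vdash s : a$ and $\pi'$ is a type derivation of $\gamma \vdash s : a'$, then $a = a'$ and $\pi = \pi'$.
   Context: For $n\in\mathbb{N}$ let $[n]=\{1,\dots,n\}$. Resource types are given by $a ::= o \mid \vec a \multimap a$, where an intersection type $\vec a=\langle a_1,\dots,a_k\rangle$ ($k\ge 0$) is a finite ordered list of resource types; $\oplus$ denotes list concatenation. Fix a mode $\spadesuit\in\{l,c\}$. Morphisms of resource types are defined inductively: $\mathrm{id}_o:o\to o$; if $g:\vec b\to\vec a$ and $f:a\to b$ are morphisms then $(g\multimap f):(\vec a\multimap a)\to(\vec b\multimap b)$; a morphism $\langle a_1,\dots,a_n\rangle\to\langle b_1,\dots,b_m\rangle$ is a tuple $\langle\alpha;f_1,\dots,f_m\rangle$ where $\alpha:[m]\to[n]$ is a function (arbitrary if $\spadesuit=c$, a bijection if $\spadesuit=l$) and $f_i:a_{\alpha(i)}\to b_i$. A typing context $\gamma=x_1:\vec a_1,\dots,x_n:\vec a_n$ assigns intersection types to distinct variables; for contexts on the same variables, $\gamma\otimes\delta$ is pointwise list concatenation. Structural resource terms are $s ::= x \mid \lambda x^{f}.s \mid s\,\vec t$, where $\vec t=\langle t_1,\dots,t_k\rangle$ is a bag (finite ordered list of terms) and $f$ is a morphism between intersection types; terms are taken up to renaming of bound variables. Typing rules (judgments $\vdash$ for terms, $\vdash_b$ for bags): (var) $x_1:\langle\rangle,\dots,x_i:\langle a\rangle,\dots,x_n:\langle\rangle\vdash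 x_i:a$; (abs) if $\gamma,x:\vec b\vdash s:a$ and $f:\vec a\to\vec b$ then $\gamma\vdash\lambda x^{f}.s:\vec a\multimap a$; (app) if $\gamma_0\vdash s:\vec a\multimap b$ and $\gamma_1\vdash_b\vec t:\vec a$ then $\gamma_0\otimes\gamma_1\vdash s\vec t:b$; (bag) if $\gamma_i\vdash t_i:a_i$ for $i=1,\dots,k$ then $\gamma_1\otimes\cdots\otimes\gamma_k\vdash_b\langle t_1,\dots,t_k\rangle:\langle a_1,\dots,a_k\rangle$. In multi-premise rules the contexts are on the same set of variables. -}

module Defs where

open import Data.Nat using (ℕ; suc)
open import Data.Fin using (Fin)
open import Data.List using (List; []; _∷_; [_]; _++_; length; lookup)
open import Data.Vec using (Vec; replicate; zipWith; _[_]≔_) renaming (_∷_ to _∷ᵥ_)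
open import Data.Unit using (⊤)
open import Function.Definitions using (Bijective)
open import Relation.Binary.PropositionalEquality using (_≡_)

data Mode : Set where
  l c : Mode

-- Resource types  a ::= o | ⃗a ⊸ a ; intersection types are (ordered) lists
data Ty : Set where
  o   : Ty
  _⊸_ : List Ty → Ty → Ty

infixr 5 _⊸_

ModeOK : Mode → {m n : ℕ} → (Fin m → Fin n) → Set
ModeOK l α = Bijective _≡_ _≡_ α
ModeOK c α = ⊤

mutual
  data Hom (♠ : Mode) : Ty → Ty → Set where
    idₒ  : Hom ♠ o o
    _⊸ₕ_ : {as bs : List Ty} {a b : Ty} →
           IHom ♠ bs as → Hom ♠ a b → Hom ♠ (as ⊸ a) (bs ⊸ b)

  data IHom (♠ : Mode) : List Ty → List Ty → Set where
    ⟨_,_,_⟩ : {as bs : List Ty} →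
              (α : Fin (length bs) → Fin (length as)) →
              ModeOK ♠ α →
              ((i : Fin (length bs)) → Hom ♠ (lookup as (α i)) (lookup bs i)) →
              IHom ♠ as bs

-- Structural resource terms in de Bruijn form (terms up to α-renaming);
-- Tm ♠ n : terms with free variables among n variables. Bags are lists.
data Tm (♠ : Mode) (n : ℕ) : Set where
  var : Fin n → Tm ♠ n
  lam : {as bs : List Ty} → IHom ♠ as bs → Tm ♠ (suc n) → Tm ♠ n
  app : Tm ♠ n → List (Tm ♠ n) → Tm ♠ n

Ctx : ℕ → Set
Ctx n = Vec (List Ty) n

_⊗_ : {n : ℕ} → Ctx n → Ctx n → Ctx n
γ ⊗ δ = zipWith _++_ γ δ

infixr 6 _⊗_

emptyCtx : (n : ℕ) → Ctx n
emptyCtx n = replicate n []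

singleCtx : {n : ℕ} → Fin n → Ty → Ctx n
singleCtx {n} i a = emptyCtx n [ i ]≔ [ a ]

mutual
  data _⊢_∶_ {♠ : Mode} : {n : ℕ} → Ctx n → Tm ♠ n → Ty → Set where
    ⊢var : {n : ℕ} (i : Fin n) (a : Ty) → singleCtx i a ⊢ var i ∶ a
    ⊢lam : {n : ℕ} {γ : Ctx n} {as bs : List Ty} {f : IHom ♠ as bs}
           {s : Tm ♠ (suc n)} {a : Ty} →
           (bs ∷ᵥ γ) ⊢ s ∶ a → γ ⊢ lam f s ∶ (as ⊸ a)
    ⊢app : {n : ℕ} {γ₀ γ₁ : Ctx n} {s : Tm ♠ n} {ts : List (Tm ♠ n)}
           {as : List Ty} {b : Ty} →
           γ₀ ⊢ s ∶ (as ⊸ b) → γ₁ ⊢b ts ∶ as → (γ₀ ⊗ γ₁) ⊢ app s ts ∶ b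

  data _⊢b_∶_ {♠ : Mode} : {n : ℕ} → Ctx n → List (Tm ♠ n) → List Ty → Set where
    ⊢nil  : {n : ℕ} → emptyCtx n ⊢b [] ∶ []
    ⊢cons : {n : ℕ} {γ δ : Ctx n} {t : Tm ♠ n} {ts : List (Tm ♠ n)}
            {a : Ty} {as : List Ty} →
            γ ⊢ t ∶ a → δ ⊢b ts ∶ as → (γ ⊗ δ) ⊢b (t ∷ ts) ∶ (a ∷ as)

-- In a derivation of γ ⊢ s : a, the list γ(x) has exactly one entry per
-- occurrence of x in s, so the lengths of γ are determined by s alone.
-- Consequently, in the rules for application and bags, the split γ = γ₀ ⊗ γ₁
-- is forced by the subterms, and induction on s shows that both the type and
-- the derivation are unique: variables get their type from the context, and
-- abstractions carry their domain in the annotation of the bound variable.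
module Submission where

open import Defs
open import Data.Nat using (ℕ; _+_)
open import Data.Nat.Properties using (suc-injective)
open import Data.Fin using (Fin)
open import Data.Product using (Σ; _×_; _,_; uncurry)
open import Data.List using (List; []; _∷_; [_]; _++_; length)
import Data.List.Properties as List
open import Data.Vec using (Vec; map; zipWith; replicate; tail; lookup; _[_]≔_)
  renaming ([] to []ᵥ; _∷_ to _∷ᵥ_)
import Data.Vec.Properties as Vec
open import Relation.Nullary using (yes; no)
open import Relation.Nullary.Decidable using (map′; _×-dec_)
open import Relation.Binary.Definitions using (DecidableEquality)
open import Relation.Binary.PropositionalEquality
  using (_≡_; refl; sym; trans; cong; cong₂; subst; subst₂; module ≡-Reasoning)
open import Axiom.UniquenessOfIdentityProofs using (module Decidable⇒UIP)

private
  variable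
    A : Set
    ♠ : Mode
    n : ℕ
    γ γ′ : Ctx n
    s : Tm ♠ n
    ts : List (Tm ♠ n)
    a a′ : Ty
    as as′ : List Ty

⊸-injective : as ⊸ a ≡ as′ ⊸ a′ → as ≡ as′ × a ≡ a′
⊸-injective refl = refl , refl

infix 4 _≟ᵀ_ _≟ᴸ_

mutual
  _≟ᵀ_ : DecidableEquality Ty
  o ≟ᵀ o = yes refl
  o ≟ᵀ (_ ⊸ _) = no λ ()
  (_ ⊸ _) ≟ᵀ o = no λ ()
  (as ⊸ a) ≟ᵀ (bs ⊸ b) = map′ (uncurry (cong₂ _⊸_)) ⊸-injective (as ≟ᴸ bs ×-dec a ≟ᵀ b)

  _≟ᴸ_ : DecidableEquality (List Ty)
  [] ≟ᴸ [] = yes refl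
  [] ≟ᴸ (_ ∷ _) = no λ ()
  (_ ∷ _) ≟ᴸ [] = no λ ()
  (a ∷ as) ≟ᴸ (b ∷ bs) = List.∷-dec (a ≟ᵀ b) (as ≟ᴸ bs)

Ctx-irrelevant : (e e′ : γ ≡ γ′) → e ≡ e′
Ctx-irrelevant = Decidable⇒UIP.≡-irrelevant (Vec.≡-dec _≟ᴸ_)

mutual
  occurrences : Tm ♠ n → Vec ℕ n
  occurrences {n = n} (var i) = replicate n 0 [ i ]≔ 1
  occurrences (lam _ s) = tail (occurrences s)
  occurrences (app s ts) = zipWith _+_ (occurrences s) (occurrencesᵇ ts)

  occurrencesᵇ : List (Tm ♠ n) → Vec ℕ n
  occurrencesᵇ {n = n} [] = replicate n 0
  occurrencesᵇ (t ∷ ts) = zipWith _+_ (occurrences t) (occurrencesᵇ ts)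

lengths-emptyCtx : ∀ n → map length (emptyCtx n) ≡ replicate n 0
lengths-emptyCtx n = Vec.map-replicate length [] n

lengths-singleCtx : ∀ (i : Fin n) a → map length (singleCtx i a) ≡ replicate n 0 [ i ]≔ 1
lengths-singleCtx {n} i a = begin
  map length (emptyCtx n [ i ]≔ [ a ])  ≡⟨ Vec.map-[]≔ length (emptyCtx n) i ⟩
  map length (emptyCtx n) [ i ]≔ 1      ≡⟨ cong (_[ i ]≔ 1) (lengths-emptyCtx n) ⟩
  replicate n 0 [ i ]≔ 1                ∎
  where open ≡-Reasoning

lengths-⊗ : ∀ (γ δ : Ctx n) → map length (γ ⊗ δ) ≡ zipWith _+_ (map length γ) (map length δ)
lengths-⊗ []ᵥ []ᵥ = refl
lengths-⊗ (xs ∷ᵥ γ) (ys ∷ᵥ δ) = cong₂ _∷ᵥ_ (List.length-++ xs) (lengths-⊗ γ δ)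

mutual
  ⊢⇒lengths≡occurrences : γ ⊢ s ∶ a → map length γ ≡ occurrences s
  ⊢⇒lengths≡occurrences (⊢var i a) = lengths-singleCtx i a
  ⊢⇒lengths≡occurrences (⊢lam π) = cong tail (⊢⇒lengths≡occurrences π)
  ⊢⇒lengths≡occurrences (⊢app {γ₀ = γ₀} {γ₁} π ρ) = trans (lengths-⊗ γ₀ γ₁)
    (cong₂ (zipWith _+_) (⊢⇒lengths≡occurrences π) (⊢b⇒lengths≡occurrencesᵇ ρ))

  ⊢b⇒lengths≡occurrencesᵇ : γ ⊢b ts ∶ as → map length γ ≡ occurrencesᵇ ts
  ⊢b⇒lengths≡occurrencesᵇ ⊢nil = lengths-emptyCtx _
  ⊢b⇒lengths≡occurrencesᵇ (⊢cons {γ = γ} {δ} π ρ) = trans (lengths-⊗ γ δ)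
    (cong₂ (zipWith _+_) (⊢⇒lengths≡occurrences π) (⊢b⇒lengths≡occurrencesᵇ ρ))

same-lengths : γ ⊢ s ∶ a → γ′ ⊢ s ∶ a′ → map length γ ≡ map length γ′
same-lengths π π′ = trans (⊢⇒lengths≡occurrences π) (sym (⊢⇒lengths≡occurrences π′))

++-cancel-by-length : ∀ (xs xs′ : List A) {ys ys′ : List A} →
  length xs ≡ length xs′ → xs ++ ys ≡ xs′ ++ ys′ → xs ≡ xs′ × ys ≡ ys′
++-cancel-by-length [] [] _ eq = refl , eq
++-cancel-by-length (x ∷ xs) (x′ ∷ xs′) len eq with List.∷-injective eq
... | refl , eq′ with ++-cancel-by-length xs xs′ (suc-injective len) eq′
...   | refl , refl = refl , refl

⊗-cancel-by-lengths : ∀ (γ₀ δ₀ : Ctx n) {γ₁ δ₁ : Ctx n} →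
  map length γ₀ ≡ map length δ₀ → γ₀ ⊗ γ₁ ≡ δ₀ ⊗ δ₁ → γ₀ ≡ δ₀ × γ₁ ≡ δ₁
⊗-cancel-by-lengths []ᵥ []ᵥ {[]ᵥ} {[]ᵥ} _ _ = refl , refl
⊗-cancel-by-lengths (xs ∷ᵥ γ₀) (ys ∷ᵥ δ₀) {_ ∷ᵥ _} {_ ∷ᵥ _} lens eq
  with Vec.∷-injective lens | Vec.∷-injective eq
... | len , lens′ | eqₕ , eqₜ
  with ++-cancel-by-length xs ys len eqₕ | ⊗-cancel-by-lengths γ₀ δ₀ lens′ eqₜ
...   | refl , refl | refl , refl = refl , refl

singleCtx-injective : ∀ (i : Fin n) → singleCtx i a ≡ singleCtx i a′ → a ≡ a′
singleCtx-injective {n} {a} {a′} i eq = List.∷-injectiveˡ (begin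
  [ a ]                                   ≡⟨ sym (Vec.lookup∘update i (emptyCtx n) [ a ]) ⟩
  lookup (singleCtx i a) i                ≡⟨ cong (λ γ → lookup γ i) eq ⟩
  lookup (singleCtx i a′) i               ≡⟨ Vec.lookup∘update i (emptyCtx n) [ a′ ] ⟩
  [ a′ ]                                  ∎)
  where open ≡-Reasoning

-- The contexts are related by an equation because the conclusions γ₀ ⊗ γ₁ and
-- δ₀ ⊗ δ₁ of two derivations do not unify by pattern matching.
mutual
  ⊢-unique : (π : γ ⊢ s ∶ a) (π′ : γ′ ⊢ s ∶ a′) (e : γ ≡ γ′) →
             Σ (a ≡ a′) λ e′ → subst₂ (λ δ b → δ ⊢ s ∶ b) e e′ π ≡ π′
  ⊢-unique (⊢var i a) (⊢var i a′) e with singleCtx-injective i e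
  ... | refl rewrite Ctx-irrelevant e refl = refl , refl
  ⊢-unique (⊢lam π) (⊢lam π′) refl with ⊢-unique π π′ refl
  ... | refl , refl = refl , refl
  ⊢-unique (⊢app {γ₀ = γ₀} π ρ) (⊢app {γ₀ = δ₀} π′ ρ′) e
    with ⊗-cancel-by-lengths γ₀ δ₀ (same-lengths π π′) e
  ... | refl , refl with ⊢-unique π π′ refl | ⊢b-unique ρ ρ′ refl
  ...   | refl , refl | refl , refl rewrite Ctx-irrelevant e refl = refl , refl

  ⊢b-unique : (ρ : γ ⊢b ts ∶ as) (ρ′ : γ′ ⊢b ts ∶ as′) (e : γ ≡ γ′) →
              Σ (as ≡ as′) λ e′ → subst₂ (λ δ bs → δ ⊢b ts ∶ bs) e e′ ρ ≡ ρ′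
  ⊢b-unique ⊢nil ⊢nil e rewrite Ctx-irrelevant e refl = refl , refl
  ⊢b-unique (⊢cons {γ = γ₀} π ρ) (⊢cons {γ = δ₀} π′ ρ′) e
    with ⊗-cancel-by-lengths γ₀ δ₀ (same-lengths π π′) e
  ... | refl , refl with ⊢-unique π π′ refl | ⊢b-unique ρ ρ′ refl
  ...   | refl , refl | refl , refl rewrite Ctx-irrelevant e refl = refl , refl

mainTheorem1 : (♠ : Mode) (n : ℕ) (γ : Ctx n) (s : Tm ♠ n) (a a′ : Ty)
    (π : γ ⊢ s ∶ a) (π′ : γ ⊢ s ∶ a′) →
    Σ (a ≡ a′) (λ e → subst (λ b → γ ⊢ s ∶ b) e π ≡ π′)
mainTheorem1 ♠ n γ s a a′ π π′ with ⊢-unique π π′ refl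
... | refl , π≡π′ = refl , π≡π′
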